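{- Let $k\ge1$, let $e_1,\ldots,e_t$ be positive integers, and let $r_1,\ldots,r_t\in\{0,\ldots,k\}$. Then \[ R_<\big(M_{e_1}^{k,r_1},\ldots,M_{e_t}^{k,r_t}\big)\geq k\left(1+\sum_{i=1}^t (e_i-1)\right). \]
   Context: An ordered $k$-uniform hypergraph is a $k$-uniform hypergraph with a totally ordered vertex set. An ordered hypergraph $G$ is contained in an ordered hypergraph $H$ if there is an injective order-preserving map $V(G)\to V(H)$ sending every edge of $G$ to an edge of $H$. $K_N^k$ is the complete $k$-uniform hypergraph on $[N]=\{1,\dots,N\}$ with the natural order. For ordered $k$-uniform hypergraphs $G_1,\dots,G_t$, $R_<(G_1,\dots,G_t)$ is the least $N$ such that for every coloring $c:E(K_N^k)\to[t]$ there is a color $j$ such that the hypergraph formed by the edges of color $j$ contains $G_j$. For $0\le r\le k$ and $e\ge1$, the $(k,r)$-nested matching $M_e^{k,r}$ is the ordered $k$-uniform hypergraph on a set of integers (ordered as integers) defined iteratively: $M_1^{k,r}$ has the single edge $A_1=[k]$, and $M_{e+1}^{k,r}$ consists of the edges of $M_e^{k,r}$ together with an edge $A_{e+1}$ consisting of the $r$ least integers greater than $\max V(M_e^{k,r})$ and the $k-r$ greatest integers less than $\min V(M_e^{k,r})$. -}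

module Defs where

open import Data.Nat as ℕ using (ℕ; zero; suc; _≤_; _<_; _∸_)
open import Data.Integer as ℤ using (ℤ; +_; _⊓_; _⊔_)
open import Data.Fin using (Fin)
open import Data.List using (List; []; _∷_; _++_; [_]; map; concat; foldr; length; allFin)
open import Data.Nat.ListAction using (sum)
open import Data.List.Relation.Unary.All using (All)
open import Data.List.Relation.Unary.Any using (Any)
open import Data.List.Relation.Unary.Linked using (Linked)
open import Data.List.Membership.Propositional using (_∈_)
open import Data.Product using (Σ; ∃; _×_; _,_)
open import Relation.Binary.PropositionalEquality using (_≡_)

-- Ordered k-uniform hypergraphs whose vertices are integers (ordered as
-- integers).  A hypergraph is given by its list of edges; each edge (a
-- k-set) is represented as the strictly increasing list of its elements.
-- The vertex set V(G) is the union of the edges (no isolated vertices,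
-- which is the case for the nested matchings).

record OHypergraph : Set where
  constructor mkOH
  field
    edges : List (List ℤ)

open OHypergraph public

vertices : OHypergraph → List ℤ
vertices G = concat (edges G)

IsKSubset : ℕ → ℕ → List ℕ → Set
IsKSubset N k S = Linked _<_ S × length S ≡ k × All (λ x → 1 ≤ x × x ≤ N) S

-- A t-colouring of the edges of K_N^k.  The proof that S is a k-subset
-- is irrelevant, so the colour depends only on the set S.
Colouring : ℕ → ℕ → ℕ → Set
Colouring k t N = (S : List ℕ) → .(IsKSubset N k S) → Fin t

-- G is contained in the colour-j subhypergraph of colouring c of K_N^k:
-- there is an order-preserving (hence injective) map φ : V(G) → [N]
-- sending every edge of G to an edge of K_N^k of colour j.
ContainedInColour : (k t N : ℕ) → OHypergraph → Colouring k t N → Fin t → Set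
ContainedInColour k t N G c j =
  Σ (ℤ → ℕ) λ φ →
    (∀ {x y} → x ∈ vertices G → y ∈ vertices G → x ℤ.< y → φ x ℕ.< φ y) ×
    All (λ A → Σ (IsKSubset N k (map φ A)) λ p → c (map φ A) p ≡ j) (edges G)

Arrows : (k t : ℕ) → (Fin t → OHypergraph) → ℕ → Set
Arrows k t G N = (c : Colouring k t N) → ∃ λ j → ContainedInColour k t N (G j) c j

IsOrderedRamseyNumber : (k t : ℕ) → (Fin t → OHypergraph) → ℕ → Set
IsOrderedRamseyNumber k t G R = Arrows k t G R × (∀ N → Arrows k t G N → R ≤ N)

range : ℤ → ℕ → List ℤ
range a zero = []
range a (suc n) = a ∷ range (a ℤ.+ + 1) n

listMin : List ℤ → ℤ
listMin [] = + 0
listMin (x ∷ xs) = foldr _⊓_ x xs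

listMax : List ℤ → ℤ
listMax [] = + 0
listMax (x ∷ xs) = foldr _⊔_ x xs

-- nestedAux k r e = edge list of M_{e+1}^{k,r}
nestedAux : ℕ → ℕ → ℕ → List (List ℤ)
nestedAux k r zero = [ range (+ 1) k ]
nestedAux k r (suc e) =
  let es = nestedAux k r e
      mn = listMin (concat es)
      mx = listMax (concat es)
  in es ++ [ range (mn ℤ.- + (k ∸ r)) (k ∸ r) ++ range (mx ℤ.+ + 1) r ]

-- M_e^{k,r} (meaningful for e ≥ 1)
NestedMatching : (k r e : ℕ) → OHypergraph
NestedMatching k r e = mkOH (nestedAux k r (e ∸ 1))

sumFin : (t : ℕ) → (Fin t → ℕ) → ℕ
sumFin t f = sum (map f (allFin t))

module Submission where

-- Let N < k (1 + Σ_i (e_i − 1)).  A k-subset s_1 < … < s_k of [N] has k + 1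
-- positive gaps g_q = s_{q+1} − s_q (s_0 = 0, s_{k+1} = N + 1) summing to
-- N + 1.  Colour i watches the gap at position p_i = k − r_i through a window
-- of width w_i = k (e_i − 1), the windows on one position being stacked from
-- 0 upwards.  As Σ_q g_q = N + 1 ≤ k + Σ_i w_i, a pigeonhole argument puts
-- some gap into the window of its colour, which colours the set.  Conversely
-- the vertices of M_e^{k,r} form an integer interval, the last edge A_e
-- surrounds it, and an order-preserving map expands distances; so in a copy
-- the gap of A_e at position k − r exceeds that of A_1 by at least k (e − 1),
-- and both cannot lie in one window of colour i.

open import Defs
open import Data.Nat
  using (ℕ; zero; suc; _≤_; _<_; _*_; _+_; _∸_; z≤n; s≤s; _≤?_; _<?_; _≟_)
open import Data.Nat.Properties
open import Data.Nat.Tactic.RingSolver using (solve-∀)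
open import Data.Nat.ListAction using (sum)
open import Data.Fin using (Fin; zero; suc)
open import Data.Fin.Properties using (any?)
open import Data.Integer as ℤ using (ℤ; +_; _⊓_; _⊔_)
import Data.Integer.Properties as ℤ
open import Data.Integer.Tactic.RingSolver renaming (solve-∀ to ℤ-solve-∀)
open import Data.List using (List; []; _∷_; _++_; [_]; map; concat; length)
import Data.List.Properties as List
open import Data.List.Relation.Unary.All as All using (All; _∷_)
open import Data.List.Relation.Unary.Any as Any using (here; there)
open import Data.List.Relation.Unary.Linked using (Linked; [-]; _∷_)
open import Data.List.Membership.Propositional using (_∈_)
open import Data.List.Membership.Propositional.Properties using (∈-++⁺ˡ; ∈-++⁺ʳ)
open import Data.List.Relation.Binary.Permutation.Propositional
  using (_↭_; ↭-reflexive; ↭-sym; module PermutationReasoning)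
open import Data.List.Relation.Binary.Permutation.Propositional.Properties
  using (∈-resp-↭; ++⁺ʳ; shifts)
open import Data.Product using (∃; _×_; _,_; proj₁; proj₂)
open import Data.Sum using (_⊎_; inj₁; inj₂)
open import Data.Empty using (⊥-elim)
import Data.Empty.Irrelevant as Irrelevant
open import Relation.Nullary using (Dec; yes; no; ¬_)
open import Relation.Nullary.Decidable using (_×-dec_)
open import Relation.Binary.PropositionalEquality
  using (_≡_; _≢_; refl; sym; trans; cong; cong₂; subst; module ≡-Reasoning)

sumTo : ℕ → (ℕ → ℕ) → ℕ
sumTo zero    f = f 0
sumTo (suc n) f = f 0 + sumTo n (λ q → f (suc q))

sumTo-zero : ∀ n → sumTo n (λ _ → 0) ≡ 0
sumTo-zero zero    = refl
sumTo-zero (suc n) = sumTo-zero n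

sumTo-< : ∀ n (f h : ℕ → ℕ) → (∀ q → q ≤ n → f q < h q) →
          sumTo n f + suc n ≤ sumTo n h
sumTo-< zero    f h f<h = subst (_≤ h 0) (+-comm 1 (f 0)) (f<h 0 z≤n)
sumTo-< (suc n) f h f<h = begin
  f 0 + sumTo n f′ + suc (suc n)   ≡⟨ regroup (f 0) (sumTo n f′) n ⟩
  suc (f 0) + (sumTo n f′ + suc n) ≤⟨ +-mono-≤ (f<h 0 z≤n) tail ⟩
  h 0 + sumTo n h′                 ∎
  where
  open ≤-Reasoning
  f′ h′ : ℕ → ℕ
  f′ q = f (suc q)
  h′ q = h (suc q)
  tail : sumTo n f′ + suc n ≤ sumTo n h′
  tail = sumTo-< n f′ h′ (λ q q≤n → f<h (suc q) (s≤s q≤n))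
  regroup : ∀ a s n → a + s + suc (suc n) ≡ suc a + (s + suc n)
  regroup = solve-∀

bump : (ℕ → ℕ) → ℕ → ℕ → ℕ → ℕ
bump o zero    w zero    = o 0 + w
bump o zero    w (suc q) = o (suc q)
bump o (suc p) w zero    = o 0
bump o (suc p) w (suc q) = bump (λ x → o (suc x)) p w q

bump-at : ∀ o p w → bump o p w p ≡ o p + w
bump-at o zero    w = refl
bump-at o (suc p) w = bump-at (λ x → o (suc x)) p w

bump-elsewhere : ∀ o p w q → q ≢ p → bump o p w q ≡ o q
bump-elsewhere o zero    w zero    q≢p = ⊥-elim (q≢p refl)
bump-elsewhere o zero    w (suc q) q≢p = refl
bump-elsewhere o (suc p) w zero    q≢p = refl
bump-elsewhere o (suc p) w (suc q) q≢p =
  bump-elsewhere (λ x → o (suc x)) p w q (λ q≡p → q≢p (cong suc q≡p))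

sumTo-bump : ∀ n o p w → p ≤ n → sumTo n (bump o p w) ≡ sumTo n o + w
sumTo-bump zero    o zero    w z≤n       = refl
sumTo-bump (suc n) o zero    w z≤n       = swap (o 0) w (sumTo n (λ q → o (suc q)))
  where
  swap : ∀ a w s → a + w + s ≡ a + s + w
  swap = solve-∀
sumTo-bump (suc n) o (suc p) w (s≤s p≤n) = trans
  (cong (λ s → o 0 + s) (sumTo-bump n (λ q → o (suc q)) p w p≤n))
  (sym (+-assoc (o 0) _ w))

sumFin-suc : ∀ t (f : Fin (suc t) → ℕ) →
             sumFin (suc t) f ≡ f zero + sumFin t (λ i → f (suc i))
sumFin-suc t f = cong (λ xs → f zero + sum xs)
  (trans (List.map-tabulate suc f) (sym (List.map-tabulate (λ i → i) (λ i → f (suc i)))))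

*-sumFin : ∀ k t (f : Fin t → ℕ) → k * sumFin t f ≡ sumFin t (λ i → k * f i)
*-sumFin k zero    f = *-zeroʳ k
*-sumFin k (suc t) f = begin
  k * sumFin (suc t) f                          ≡⟨ cong (k *_) (sumFin-suc t f) ⟩
  k * (f zero + sumFin t (λ i → f (suc i)))     ≡⟨ *-distribˡ-+ k (f zero) _ ⟩
  k * f zero + k * sumFin t (λ i → f (suc i))   ≡⟨ cong (λ s → k * f zero + s) (*-sumFin k t (λ i → f (suc i))) ⟩
  k * f zero + sumFin t (λ i → k * f (suc i))   ≡⟨ sym (sumFin-suc t (λ i → k * f i)) ⟩
  sumFin (suc t) (λ i → k * f i)                ∎
  where open ≡-Reasoning

InWindow : ℕ → ℕ → ℕ → Set
InWindow a w x = a < x × x ≤ a + w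

inWindow? : ∀ a w x → Dec (InWindow a w x)
inWindow? a w x = (a <? x) ×-dec (x ≤? a + w)

-- Colours 0, 1, … in turn put a window of width W i on position P i; the
-- windows on one position are stacked, starting above the offsets o.
-- offset P W o j is the lower end of the window of colour j.
offset : ∀ {t} → (P W : Fin t → ℕ) → (ℕ → ℕ) → Fin t → ℕ
offset P W o zero    = o (P zero)
offset P W o (suc j) =
  offset (λ i → P (suc i)) (λ i → W (suc i)) (bump o (P zero) (W zero)) j

window-exists : ∀ n t (P W : Fin t → ℕ) (o g : ℕ → ℕ) →
  (∀ i → P i ≤ n) → (∀ q → q ≤ n → o q < g q) →
  sumTo n g ≤ sumTo n o + sumFin t W + n →
  ∃ λ j → InWindow (offset P W o j) (W j) (g (P j))
window-exists n zero P W o g P≤n o<g room = ⊥-elim (1+n≰n (begin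
  suc (sumTo n o + n)  ≡⟨ sym (+-suc (sumTo n o) n) ⟩
  sumTo n o + suc n    ≤⟨ sumTo-< n o g o<g ⟩
  sumTo n g            ≤⟨ room ⟩
  sumTo n o + 0 + n    ≡⟨ cong (_+ n) (+-identityʳ (sumTo n o)) ⟩
  sumTo n o + n        ∎))
  where open ≤-Reasoning
window-exists n (suc t) P W o g P≤n o<g room
  with inWindow? (o (P zero)) (W zero) (g (P zero))
... | yes inside = zero , inside
... | no outside =
  let j , inside = window-exists n t (λ i → P (suc i)) (λ i → W (suc i)) o′ g
                     (λ i → P≤n (suc i)) o′<g room′
  in suc j , inside
  where
  o′ : ℕ → ℕ
  o′ = bump o (P zero) (W zero)
  above : o (P zero) + W zero < g (P zero)
  above = ≰⇒> (λ g≤ → outside (o<g (P zero) (P≤n zero) , g≤))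
  o′<g : ∀ q → q ≤ n → o′ q < g q
  o′<g q q≤n with q ≟ P zero
  ... | yes refl = subst (_< g q) (sym (bump-at o q (W zero))) above
  ... | no q≢p   = subst (_< g q) (sym (bump-elsewhere o (P zero) (W zero) q q≢p)) (o<g q q≤n)
  room′ : sumTo n g ≤ sumTo n o′ + sumFin t (λ i → W (suc i)) + n
  room′ = begin
    sumTo n g                                                   ≤⟨ room ⟩
    sumTo n o + sumFin (suc t) W + n                            ≡⟨ cong (λ s → sumTo n o + s + n) (sumFin-suc t W) ⟩
    sumTo n o + (W zero + sumFin t (λ i → W (suc i))) + n       ≡⟨ cong (_+ n) (sym (+-assoc (sumTo n o) (W zero) _)) ⟩
    sumTo n o + W zero + sumFin t (λ i → W (suc i)) + n         ≡⟨ cong (λ s → s + sumFin t (λ i → W (suc i)) + n)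
                                                                     (sym (sumTo-bump n o (P zero) (W zero) (P≤n zero))) ⟩
    sumTo n o′ + sumFin t (λ i → W (suc i)) + n                 ∎
    where open ≤-Reasoning

-- gapAt prev S N q is the q-th gap of the sequence prev, S, N + 1:
-- (element q + 1) − (element q), counting prev as element 0.
gapAt : ℕ → List ℕ → ℕ → ℕ → ℕ
gapAt prev []       N q       = suc N ∸ prev
gapAt prev (x ∷ xs) N zero    = x ∸ prev
gapAt prev (x ∷ xs) N (suc q) = gapAt x xs N q

gapAt-pos : ∀ prev S N q → Linked _<_ (prev ∷ S) → All (_≤ N) S → prev ≤ N →
            0 < gapAt prev S N q
gapAt-pos prev []       N q       _           _           prev≤N = m<n⇒0<n∸m (s≤s prev≤N)
gapAt-pos prev (x ∷ xs) N zero    (prev<x ∷ _) _          _      = m<n⇒0<n∸m prev<x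
gapAt-pos prev (x ∷ xs) N (suc q) (_ ∷ incr)  (x≤N ∷ xs≤N) _     = gapAt-pos x xs N q incr xs≤N x≤N

gapAt-sum : ∀ prev S N → Linked _<_ (prev ∷ S) → All (_≤ N) S → prev ≤ N →
            sumTo (length S) (gapAt prev S N) + prev ≡ suc N
gapAt-sum prev []       N _            _            prev≤N = m∸n+n≡m (m≤n⇒m≤1+n prev≤N)
gapAt-sum prev (x ∷ xs) N (prev<x ∷ incr) (x≤N ∷ xs≤N) _ = begin
  x ∸ prev + s + prev   ≡⟨ rearrange (x ∸ prev) s prev ⟩
  x ∸ prev + prev + s   ≡⟨ cong (_+ s) (m∸n+n≡m (<⇒≤ prev<x)) ⟩
  x + s                 ≡⟨ +-comm x s ⟩
  s + x                 ≡⟨ gapAt-sum x xs N incr xs≤N x≤N ⟩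
  suc N                 ∎
  where
  open ≡-Reasoning
  s : ℕ
  s = sumTo (length xs) (gapAt x xs N)
  rearrange : ∀ d s a → d + s + a ≡ d + a + s
  rearrange = solve-∀

prepend-0 : ∀ S → Linked _<_ S → All (1 ≤_) S → Linked _<_ (0 ∷ S)
prepend-0 []      _    _          = [-]
prepend-0 (_ ∷ _) incr (1≤x ∷ _) = 1≤x ∷ incr

kSubset-gaps : ∀ N k S → IsKSubset N k S →
  (∀ q → 0 < gapAt 0 S N q) × sumTo k (gapAt 0 S N) ≡ suc N
kSubset-gaps N k S (incr , refl , bounds) =
  (λ q → gapAt-pos 0 S N q incr₀ S≤N z≤n) ,
  trans (sym (+-identityʳ _)) (gapAt-sum 0 S N incr₀ S≤N z≤n)
  where
  S≤N : All (_≤ N) S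
  S≤N = All.map proj₂ bounds
  incr₀ : Linked _<_ (0 ∷ S)
  incr₀ = prepend-0 S incr (All.map proj₁ bounds)

-- A witness of a decided existential; the (irrelevant) proof of existence
-- only serves to rule out the negative answer.
choose : ∀ {t} {Q : Fin t → Set} → Dec (∃ Q) → .(∃ Q) → Fin t
choose (yes (j , _)) _ = j
choose (no ∄)        ∃ = Irrelevant.⊥-elim (∄ ∃)

choose-sound : ∀ {t} {Q : Fin t → Set} (d : Dec (∃ Q)) .(e : ∃ Q) {j} →
               choose d e ≡ j → Q j
choose-sound (yes (j , Qj)) _ refl = Qj
choose-sound (no ∄)         e _    = Irrelevant.⊥-elim (∄ e)

module WindowColouring (k t N : ℕ) (P W : Fin t → ℕ)
                       (P≤k : ∀ i → P i ≤ k) (small : suc N ≤ sumFin t W + k) where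

  Fits : List ℕ → Fin t → Set
  Fits S j = InWindow (offset P W (λ _ → 0) j) (W j) (gapAt 0 S N (P j))

  some-fit : ∀ S → IsKSubset N k S → ∃ (Fits S)
  some-fit S S∈ = window-exists k t P W (λ _ → 0) (gapAt 0 S N) P≤k
    (λ q _ → proj₁ gaps q)
    (begin
      sumTo k (gapAt 0 S N)                     ≡⟨ proj₂ gaps ⟩
      suc N                                     ≤⟨ small ⟩
      sumFin t W + k                            ≡⟨ cong (λ z → z + sumFin t W + k) (sym (sumTo-zero k)) ⟩
      sumTo k (λ _ → 0) + sumFin t W + k        ∎)
    where
    open ≤-Reasoning
    gaps : (∀ q → 0 < gapAt 0 S N q) × sumTo k (gapAt 0 S N) ≡ suc N
    gaps = kSubset-gaps N k S S∈

  colouring : Colouring k t N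
  colouring S S∈ = choose (any? (λ j → inWindow? _ _ _)) (some-fit S S∈)

  colouring-fits : ∀ S .(S∈ : IsKSubset N k S) {j} → colouring S S∈ ≡ j → Fits S j
  colouring-fits S S∈ = choose-sound (any? (λ j → inWindow? _ _ _)) (some-fit S S∈)

+-shift : ∀ a i j → a ℤ.+ + i ℤ.+ + j ≡ a ℤ.+ + (i + j)
+-shift a i j = trans (ℤ.+-assoc a (+ i) (+ j)) (cong (λ s → a ℤ.+ s) (sym (ℤ.pos-+ i j)))

range-++ : ∀ m n a → range a (m + n) ≡ range a m ++ range (a ℤ.+ + m) n
range-++ zero    n a = cong (λ b → range b n) (sym (ℤ.+-identityʳ a))
range-++ (suc m) n a = cong (a ∷_) (trans (range-++ m n (a ℤ.+ + 1))
  (cong (λ b → range (a ℤ.+ + 1) m ++ range b n) (+-shift a 1 m)))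

length-range : ∀ m a → length (range a m) ≡ m
length-range zero    a = refl
length-range (suc m) a = cong suc (length-range m (a ℤ.+ + 1))

range-∈ : ∀ m a i → i < m → a ℤ.+ + i ∈ range a m
range-∈ (suc m) a zero    _         = here (ℤ.+-identityʳ a)
range-∈ (suc m) a (suc i) (s≤s i<m) =
  there (subst (_∈ range (a ℤ.+ + 1) m) (+-shift a 1 i) (range-∈ m (a ℤ.+ + 1) i i<m))

∈-range : ∀ m a z → z ∈ range a m → ∃ λ i → i < m × z ≡ a ℤ.+ + i
∈-range (suc m) a z (here z≡a) = 0 , s≤s z≤n , trans z≡a (sym (ℤ.+-identityʳ a))
∈-range (suc m) a z (there z∈) =
  let i , i<m , z≡ = ∈-range m (a ℤ.+ + 1) z z∈
  in suc i , s≤s i<m , trans z≡ (+-shift a 1 i)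

headOr : ℕ → List ℕ → ℕ
headOr d []      = d
headOr d (x ∷ _) = x

lastOr : ℕ → List ℕ → ℕ
lastOr d []       = d
lastOr d (x ∷ xs) = lastOr x xs

last-range : ∀ (φ : ℤ → ℕ) m b d → lastOr d (map φ (range b (suc m))) ≡ φ (b ℤ.+ + m)
last-range φ zero    b d = cong φ (sym (ℤ.+-identityʳ b))
last-range φ (suc m) b d = trans (last-range φ m (b ℤ.+ + 1) (φ b)) (cong φ (+-shift b 1 m))

listMin-unique : ∀ xs m → m ∈ xs → (∀ {z} → z ∈ xs → m ℤ.≤ z) → listMin xs ≡ m
listMin-unique (x ∷ ys) m m∈ lower = ℤ.≤-antisym
  (List.foldr-preservesᵒ below x ys (reached m∈))
  (List.foldr-preservesᵇ ℤ.⊓-glb (lower (here refl)) (All.tabulate (λ z∈ → lower (there z∈))))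
  where
  below : ∀ u v → u ℤ.≤ m ⊎ v ℤ.≤ m → u ⊓ v ℤ.≤ m
  below u v (inj₁ u≤m) = ℤ.i≤j⇒i⊓k≤j v u≤m
  below u v (inj₂ v≤m) = ℤ.i≤j⇒k⊓i≤j u v≤m
  reached : m ∈ x ∷ ys → x ℤ.≤ m ⊎ Any.Any (ℤ._≤ m) ys
  reached (here refl) = inj₁ ℤ.≤-refl
  reached (there m∈)  = inj₂ (Any.map (λ { refl → ℤ.≤-refl }) m∈)

listMax-unique : ∀ xs m → m ∈ xs → (∀ {z} → z ∈ xs → z ℤ.≤ m) → listMax xs ≡ m
listMax-unique (x ∷ ys) m m∈ upper = ℤ.≤-antisym
  (List.foldr-preservesᵇ ℤ.⊔-lub (upper (here refl)) (All.tabulate (λ z∈ → upper (there z∈))))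
  (List.foldr-preservesᵒ above x ys (reached m∈))
  where
  above : ∀ u v → m ℤ.≤ u ⊎ m ℤ.≤ v → m ℤ.≤ u ⊔ v
  above u v (inj₁ m≤u) = ℤ.i≤j⇒i≤j⊔k v m≤u
  above u v (inj₂ m≤v) = ℤ.i≤j⇒i≤k⊔j u m≤v
  reached : m ∈ x ∷ ys → m ℤ.≤ x ⊎ Any.Any (m ℤ.≤_) ys
  reached (here refl) = inj₁ ℤ.≤-refl
  reached (there m∈)  = inj₂ (Any.map (λ { refl → ℤ.≤-refl }) m∈)

interval-extremes : ∀ xs a m → xs ↭ range a (suc m) →
                    listMin xs ≡ a × listMax xs ≡ a ℤ.+ + m
interval-extremes xs a m xs↭ =
  listMin-unique xs a (from (subst (_∈ range a (suc m)) (ℤ.+-identityʳ a) (range-∈ (suc m) a 0 (s≤s z≤n))))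
    (λ z∈ → let i , _ , z≡ = to z∈ in subst (a ℤ.≤_) (sym z≡) (ℤ.i≤i+j a (+ i))) ,
  listMax-unique xs (a ℤ.+ + m) (from (range-∈ (suc m) a m ≤-refl))
    (λ z∈ → let i , i<1+m , z≡ = to z∈ in subst (ℤ._≤ a ℤ.+ + m) (sym z≡) (ℤ.+-monoʳ-≤ a (ℤ.+≤+ (m<1+n⇒m≤n i<1+m))))
  where
  from : ∀ {z} → z ∈ range a (suc m) → z ∈ xs
  from = ∈-resp-↭ (↭-sym xs↭)
  to : ∀ {z} → z ∈ xs → ∃ λ i → i < suc m × z ≡ a ℤ.+ + i
  to z∈ = ∈-range (suc m) a _ (∈-resp-↭ xs↭ z∈)

increasing⇒expanding : ∀ (f : ℕ → ℕ) L → (∀ j → suc j < L → f j < f (suc j)) →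
                       ∀ i d → i + d < L → f i + d ≤ f (i + d)
increasing⇒expanding f L step i zero    _       =
  ≤-reflexive (trans (+-identityʳ (f i)) (cong f (sym (+-identityʳ i))))
increasing⇒expanding f L step i (suc d) i+1+d<L = begin
  f i + suc d      ≡⟨ +-suc (f i) d ⟩
  suc (f i + d)    ≤⟨ s≤s (increasing⇒expanding f L step i d (<-trans (n<1+n (i + d)) 1+i+d<L)) ⟩
  suc (f (i + d))  ≤⟨ step (i + d) 1+i+d<L ⟩
  f (suc (i + d))  ≡⟨ cong f (sym (+-suc i d)) ⟩
  f (i + suc d)    ∎
  where
  open ≤-Reasoning
  1+i+d<L : suc (i + d) < L
  1+i+d<L = subst (_< L) (+-suc i d) i+1+d<L

Expanding : (ℤ → ℕ) → ℤ → ℕ → Set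
Expanding φ a L = ∀ i d → i + d < L → φ (a ℤ.+ + i) + d ≤ φ (a ℤ.+ + (i + d))

order-preserving⇒expanding : ∀ φ xs a L → xs ↭ range a L →
  (∀ {x y} → x ∈ xs → y ∈ xs → x ℤ.< y → φ x < φ y) → Expanding φ a L
order-preserving⇒expanding φ xs a L xs↭ mono = increasing⇒expanding (λ i → φ (a ℤ.+ + i)) L
  (λ j 1+j<L → mono (point j (<-trans (n<1+n j) 1+j<L)) (point (suc j) 1+j<L)
                    (ℤ.+-monoʳ-< a (ℤ.+<+ (n<1+n j))))
  where
  point : ∀ i → i < L → a ℤ.+ + i ∈ xs
  point i i<L = ∈-resp-↭ (↭-sym xs↭) (range-∈ L a i i<L)

module BlockShift (φ : ℤ → ℕ) (a : ℤ) (L : ℕ) (expand : Expanding φ a L) where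

  last-shift : ∀ c x m → x + c * m + m ≤ L →
    lastOr 0 (map φ (range (a ℤ.+ + x) m)) + c * m ≤
    lastOr 0 (map φ (range (a ℤ.+ + (x + c * m)) m))
  last-shift c x zero    _    = ≤-reflexive (*-zeroʳ c)
  last-shift c x (suc m) fits = begin
    lastOr 0 (map φ (range (a ℤ.+ + x) (suc m))) + d  ≡⟨ cong (_+ d) (last-range φ m (a ℤ.+ + x) 0) ⟩
    φ (a ℤ.+ + x ℤ.+ + m) + d                         ≡⟨ cong (λ z → φ z + d) (+-shift a x m) ⟩
    φ (a ℤ.+ + (x + m)) + d                           ≤⟨ expand (x + m) d inside ⟩
    φ (a ℤ.+ + (x + m + d))                           ≡⟨ cong φ moved ⟩
    φ (a ℤ.+ + (x + d) ℤ.+ + m)                       ≡⟨ sym (last-range φ m (a ℤ.+ + (x + d)) 0) ⟩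
    lastOr 0 (map φ (range (a ℤ.+ + (x + d)) (suc m))) ∎
    where
    open ≤-Reasoning
    d : ℕ
    d = c * suc m
    reorder : ∀ x m d → x + m + d ≡ x + d + m
    reorder = solve-∀
    moved : a ℤ.+ + (x + m + d) ≡ a ℤ.+ + (x + d) ℤ.+ + m
    moved = trans (cong (λ s → a ℤ.+ + s) (reorder x m d)) (sym (+-shift a (x + d) m))
    inside : x + m + d < L
    inside = subst (_≤ L) (trans (+-suc (x + d) m) (cong suc (sym (reorder x m d)))) fits

  head-shift : ∀ N c y m → y + c * m + m ≤ L →
    headOr (suc N) (map φ (range (a ℤ.+ + y) m)) + c * m ≤
    headOr (suc N) (map φ (range (a ℤ.+ + (y + c * m)) m))
  head-shift N c y zero    _    = ≤-reflexive (trans (cong (λ s → suc N + s) (*-zeroʳ c)) (+-identityʳ (suc N)))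
  head-shift N c y (suc m) fits = expand y (c * suc m) (<-≤-trans (m<m+n _ (s≤s z≤n)) fits)

gapAt-++ : ∀ prev xs ys N → gapAt prev (xs ++ ys) N (length xs) ≡ headOr (suc N) ys ∸ lastOr prev xs
gapAt-++ prev []       []       N = refl
gapAt-++ prev []       (y ∷ ys) N = refl
gapAt-++ prev (x ∷ xs) ys       N = gapAt-++ x xs ys N

block-gap : ∀ φ N b c m n →
  gapAt 0 (map φ (range b m ++ range c n)) N m ≡
  headOr (suc N) (map φ (range c n)) ∸ lastOr 0 (map φ (range b m))
block-gap φ N b c m n = begin
  gapAt 0 (map φ (range b m ++ range c n)) N m
    ≡⟨ cong (λ l → gapAt 0 l N m) (List.map-++ φ (range b m) (range c n)) ⟩
  gapAt 0 (map φ (range b m) ++ map φ (range c n)) N m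
    ≡⟨ cong (gapAt 0 (map φ (range b m) ++ map φ (range c n)) N) (sym lower-length) ⟩
  gapAt 0 (map φ (range b m) ++ map φ (range c n)) N (length (map φ (range b m)))
    ≡⟨ gapAt-++ 0 (map φ (range b m)) (map φ (range c n)) N ⟩
  headOr (suc N) (map φ (range c n)) ∸ lastOr 0 (map φ (range b m)) ∎
  where
  open ≡-Reasoning
  lower-length : length (map φ (range b m)) ≡ m
  lower-length = trans (List.length-map φ (range b m)) (length-range m b)

∸-widen : ∀ {U L U′ L′} x y → 0 < U ∸ L → U + y ≤ U′ → L′ + x ≤ L → U ∸ L + (x + y) ≤ U′ ∸ L′
∸-widen {U} {L} {U′} {L′} x y pos U+y≤U′ L′+x≤L = m+n≤o⇒m≤o∸n (U ∸ L + (x + y)) (begin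
  U ∸ L + (x + y) + L′  ≡⟨ regroup (U ∸ L) x y L′ ⟩
  U ∸ L + (L′ + x) + y  ≤⟨ +-monoˡ-≤ y (+-monoʳ-≤ (U ∸ L) L′+x≤L) ⟩
  U ∸ L + L + y         ≡⟨ cong (_+ y) (m∸n+n≡m {U} {L} (<⇒≤ (m∸n≢0⇒n<m (λ U∸L≡0 → <-irrefl (sym U∸L≡0) pos)))) ⟩
  U + y                 ≤⟨ U+y≤U′ ⟩
  U′                    ∎)
  where
  open ≤-Reasoning
  regroup : ∀ g x y l → g + (x + y) + l ≡ g + (l + x) + y
  regroup = solve-∀

-- The nested matchings M_{n+1}^{k,r} for k = k′ + 1 and r ≤ k; p = k − r is
-- the position of the gap between the two blocks of the added edges.
module Nested (k′ r : ℕ) (r≤k : r ≤ suc k′) where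

  k p : ℕ
  k = suc k′
  p = k ∸ r

  p+r≡k : p + r ≡ k
  p+r≡k = m∸n+n≡m r≤k

  -- The vertices of M_{n+1}; they form the interval starting at lo n = 1 − n p.
  V : ℕ → List ℤ
  V n = concat (nestedAux k r n)

  lo : ℕ → ℤ
  lo n = + 1 ℤ.- + (n * p)

  lo-suc : ∀ n → lo (suc n) ℤ.+ + p ≡ lo n
  lo-suc n = trans (cong (λ z → + 1 ℤ.- z ℤ.+ + p) (ℤ.pos-+ p (n * p))) (cancel (+ p) (+ (n * p)))
    where
    cancel : ∀ P X → + 1 ℤ.- (P ℤ.+ X) ℤ.+ P ≡ + 1 ℤ.- X
    cancel = ℤ-solve-∀

  lo-pred : ∀ n → lo n ℤ.- + p ≡ lo (suc n)
  lo-pred n = trans (step (+ p) (+ (n * p))) (cong (λ z → + 1 ℤ.- z) (sym (ℤ.pos-+ p (n * p))))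
    where
    step : ∀ P X → + 1 ℤ.- X ℤ.- P ≡ + 1 ℤ.- (P ℤ.+ X)
    step = ℤ-solve-∀

  lo-first : ∀ n → lo n ℤ.+ + (n * p) ≡ + 1
  lo-first n = cancel (+ (n * p))
    where
    cancel : ∀ X → + 1 ℤ.- X ℤ.+ X ≡ + 1
    cancel = ℤ-solve-∀

  edge : ℕ → ℕ → ℕ → List ℤ
  edge n x y = range (lo n ℤ.+ + x) p ++ range (lo n ℤ.+ + y) r

  lastEdge : ℕ → List ℤ
  lastEdge zero    = range (+ 1) k
  lastEdge (suc n) = range (listMin (V n) ℤ.- + p) p ++ range (listMax (V n) ℤ.+ + 1) r

  firstEdge-∈ : ∀ n → range (+ 1) k ∈ nestedAux k r n
  firstEdge-∈ zero    = here refl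
  firstEdge-∈ (suc n) = ∈-++⁺ˡ (firstEdge-∈ n)

  lastEdge-∈ : ∀ n → lastEdge n ∈ nestedAux k r n
  lastEdge-∈ zero    = here refl
  lastEdge-∈ (suc n) = ∈-++⁺ʳ (nestedAux k r n) (here refl)

  V-suc : ∀ n → V (suc n) ≡ V n ++ lastEdge (suc n)
  V-suc n = trans (sym (List.concat-++ (nestedAux k r n) [ lastEdge (suc n) ]))
                  (cong (V n ++_) (List.++-identityʳ (lastEdge (suc n))))

  firstEdge-shape : ∀ n → range (+ 1) k ≡ edge n (n * p) (n * p + p)
  firstEdge-shape n = begin
    range (+ 1) k                       ≡⟨ cong (range (+ 1)) (sym p+r≡k) ⟩
    range (+ 1) (p + r)                 ≡⟨ range-++ p r (+ 1) ⟩
    range (+ 1) p ++ range (+ 1 ℤ.+ + p) r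
      ≡⟨ cong₂ (λ u v → range u p ++ range v r) (sym (lo-first n))
               (trans (cong (ℤ._+ + p) (sym (lo-first n))) (+-shift (lo n) (n * p) p)) ⟩
    edge n (n * p) (n * p + p)          ∎
    where open ≡-Reasoning

  lastEdge-around : ∀ n → listMin (V n) ≡ lo n → listMax (V n) ≡ lo n ℤ.+ + (k′ + n * k) →
                    lastEdge (suc n) ≡ edge (suc n) 0 (p + suc n * k)
  lastEdge-around n min≡ max≡ = cong₂ (λ u v → range u p ++ range v r) lower upper
    where
    open ≡-Reasoning
    lower : listMin (V n) ℤ.- + p ≡ lo (suc n) ℤ.+ + 0
    lower = trans (cong (ℤ._- + p) min≡) (trans (lo-pred n) (sym (ℤ.+-identityʳ (lo (suc n)))))
    m : ℕ
    m = k′ + n * k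
    upper : listMax (V n) ℤ.+ + 1 ≡ lo (suc n) ℤ.+ + (p + suc n * k)
    upper = begin
      listMax (V n) ℤ.+ + 1               ≡⟨ cong (ℤ._+ + 1) max≡ ⟩
      lo n ℤ.+ + m ℤ.+ + 1                ≡⟨ +-shift (lo n) m 1 ⟩
      lo n ℤ.+ + (m + 1)                  ≡⟨ cong (λ s → lo n ℤ.+ + s) (+-comm m 1) ⟩
      lo n ℤ.+ + suc m                    ≡⟨ cong (ℤ._+ + suc m) (sym (lo-suc n)) ⟩
      lo (suc n) ℤ.+ + p ℤ.+ + suc m      ≡⟨ +-shift (lo (suc n)) p (suc m) ⟩
      lo (suc n) ℤ.+ + (p + suc n * k)    ∎

  interval-blocks : ∀ n →
    range (lo (suc n)) (suc (suc n) * k) ≡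
    range (lo (suc n) ℤ.+ + 0) p ++ range (lo n) (suc n * k) ++ range (lo (suc n) ℤ.+ + (p + suc n * k)) r
  interval-blocks n = begin
    range a (k + l)                                  ≡⟨ cong (range a) length≡ ⟩
    range a (p + (l + r))                            ≡⟨ range-++ p (l + r) a ⟩
    range a p ++ range (a ℤ.+ + p) (l + r)           ≡⟨ cong (range a p ++_) (range-++ l r (a ℤ.+ + p)) ⟩
    range a p ++ range (a ℤ.+ + p) l ++ range (a ℤ.+ + p ℤ.+ + l) r
      ≡⟨ cong₂ (λ u v → range u p ++ range v l ++ range (a ℤ.+ + p ℤ.+ + l) r)
               (sym (ℤ.+-identityʳ a)) (lo-suc n) ⟩
    range (a ℤ.+ + 0) p ++ range (lo n) l ++ range (a ℤ.+ + p ℤ.+ + l) r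
      ≡⟨ cong (λ u → range (a ℤ.+ + 0) p ++ range (lo n) l ++ range u r) (+-shift a p l) ⟩
    range (a ℤ.+ + 0) p ++ range (lo n) l ++ range (a ℤ.+ + (p + l)) r ∎
    where
    open ≡-Reasoning
    a : ℤ
    a = lo (suc n)
    l : ℕ
    l = suc n * k
    length≡ : k + l ≡ p + (l + r)
    length≡ = trans (cong (_+ l) (sym p+r≡k)) (swap p r l)
      where
      swap : ∀ p r l → p + r + l ≡ p + (l + r)
      swap = solve-∀

  -- By induction: V n is a permutation of [lo n, lo n + (n+1) k), hence has
  -- these extrema, so A_{n+2} extends the interval by p below and r above.
  vertices-interval : ∀ n → V n ↭ range (lo n) (suc n * k)
  extremes : ∀ n → listMin (V n) ≡ lo n × listMax (V n) ≡ lo n ℤ.+ + (k′ + n * k)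

  vertices-interval zero = ↭-reflexive (trans (List.++-identityʳ (range (+ 1) k))
                                              (cong (range (+ 1)) (sym (+-identityʳ k))))
  vertices-interval (suc n) = begin
    V (suc n)                           ≡⟨ V-suc n ⟩
    V n ++ lastEdge (suc n)             ≡⟨ cong (V n ++_) (lastEdge-around n (proj₁ (extremes n)) (proj₂ (extremes n))) ⟩
    V n ++ lower ++ upper               ↭⟨ ++⁺ʳ (lower ++ upper) (vertices-interval n) ⟩
    range (lo n) (suc n * k) ++ lower ++ upper ↭⟨ shifts (range (lo n) (suc n * k)) lower ⟩
    lower ++ range (lo n) (suc n * k) ++ upper ≡⟨ sym (interval-blocks n) ⟩
    range (lo (suc n)) (suc (suc n) * k) ∎
    where
    open PermutationReasoning
    lower upper : List ℤ
    lower = range (lo (suc n) ℤ.+ + 0) p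
    upper = range (lo (suc n) ℤ.+ + (p + suc n * k)) r

  extremes n = interval-extremes (V n) (lo n) (k′ + n * k) (vertices-interval n)

  lastEdge-shape : ∀ n → lastEdge n ≡ edge n 0 (p + n * k)
  lastEdge-shape zero    = trans (firstEdge-shape 0) (cong (edge 0 0) (sym (+-identityʳ p)))
  lastEdge-shape (suc n) = lastEdge-around n (proj₁ (extremes n)) (proj₂ (extremes n))

  gap : (ℤ → ℕ) → ℕ → List ℤ → ℕ
  gap φ N A = gapAt 0 (map φ A) N p

  edge-gap : ∀ φ N n x y → gap φ N (edge n x y) ≡
    headOr (suc N) (map φ (range (lo n ℤ.+ + y) r)) ∸ lastOr 0 (map φ (range (lo n ℤ.+ + x) p))
  edge-gap φ N n x y = block-gap φ N (lo n ℤ.+ + x) (lo n ℤ.+ + y) p r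

  gap-growth : ∀ n N φ → (∀ {x y} → x ∈ V n → y ∈ V n → x ℤ.< y → φ x < φ y) →
    0 < gap φ N (range (+ 1) k) → gap φ N (range (+ 1) k) + n * k ≤ gap φ N (lastEdge n)
  gap-growth n N φ mono pos = begin
    gap φ N (range (+ 1) k) + n * k        ≡⟨ cong₂ _+_ first≡ n*k≡ ⟩
    U ∸ L + (n * p + n * r)                ≤⟨ ∸-widen (n * p) (n * r) (subst (0 <_) first≡ pos) upper lower ⟩
    U′ ∸ L′                                ≡⟨ sym (edge-gap φ N n 0 (n * p + p + n * r)) ⟩
    gap φ N (edge n 0 (n * p + p + n * r)) ≡⟨ cong (λ y → gap φ N (edge n 0 y)) outer≡ ⟩
    gap φ N (edge n 0 (p + n * k))         ≡⟨ cong (gap φ N) (sym (lastEdge-shape n)) ⟩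
    gap φ N (lastEdge n)                   ∎
    where
    open ≤-Reasoning
    open BlockShift φ (lo n) (suc n * k)
      (order-preserving⇒expanding φ (V n) (lo n) (suc n * k) (vertices-interval n) mono)
    U L U′ L′ : ℕ
    U  = headOr (suc N) (map φ (range (lo n ℤ.+ + (n * p + p)) r))
    L  = lastOr 0 (map φ (range (lo n ℤ.+ + (n * p)) p))
    U′ = headOr (suc N) (map φ (range (lo n ℤ.+ + (n * p + p + n * r)) r))
    L′ = lastOr 0 (map φ (range (lo n ℤ.+ + 0) p))
    first≡ : gap φ N (range (+ 1) k) ≡ U ∸ L
    first≡ = trans (cong (gap φ N) (firstEdge-shape n)) (edge-gap φ N n (n * p) (n * p + p))
    expand₁ : ∀ n p r → n * p + p + n * r + r ≡ p + r + n * (p + r)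
    expand₁ = solve-∀
    expand₂ : ∀ n p r → n * p + p + n * r ≡ p + n * (p + r)
    expand₂ = solve-∀
    total : n * p + p + n * r + r ≡ suc n * k
    total = trans (expand₁ n p r) (cong (λ K → K + n * K) p+r≡k)
    outer≡ : n * p + p + n * r ≡ p + n * k
    outer≡ = trans (expand₂ n p r) (cong (λ K → p + n * K) p+r≡k)
    n*k≡ : n * k ≡ n * p + n * r
    n*k≡ = trans (cong (n *_) (sym p+r≡k)) (*-distribˡ-+ n p r)
    upper : U + n * r ≤ U′
    upper = head-shift N n (n * p + p) r (≤-reflexive total)
    lower : L′ + n * p ≤ L
    lower = last-shift n 0 p (≤-trans (m≤m+n (n * p + p) (n * r))
                                      (≤-trans (m≤m+n _ r) (≤-reflexive total)))

  -- If every edge of colour j has its gap at position p inside one window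
  -- (a, a + k n], colour j contains no copy of M_{n+1}: the gaps of A_1 and
  -- A_{n+1} differ by at least k n.
  no-copy-in-window : ∀ n t N (c : Colouring k t N) j a →
    (∀ S (S∈ : IsKSubset N k S) → c S S∈ ≡ j → InWindow a (k * n) (gapAt 0 S N p)) →
    ¬ ContainedInColour k t N (mkOH (nestedAux k r n)) c j
  no-copy-in-window n t N c j a window (φ , mono , coloured) = 1+n≰n (begin
    suc (a + k * n)                          ≡⟨ cong (λ s → suc (a + s)) (*-comm k n) ⟩
    suc a + n * k                            ≤⟨ +-monoˡ-≤ (n * k) a<first ⟩
    gap φ N (range (+ 1) k) + n * k          ≤⟨ gap-growth n N φ mono (≤-trans (s≤s z≤n) a<first) ⟩
    gap φ N (lastEdge n)                     ≤⟨ last≤ ⟩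
    a + k * n                                ∎)
    where
    open ≤-Reasoning
    in-window : ∀ {A} → A ∈ nestedAux k r n → InWindow a (k * n) (gap φ N A)
    in-window A∈ = let S∈ , cS≡j = All.lookup coloured A∈ in window _ S∈ cS≡j
    a<first : a < gap φ N (range (+ 1) k)
    a<first = proj₁ (in-window (firstEdge-∈ n))
    last≤ : gap φ N (lastEdge n) ≤ a + k * n
    last≤ = proj₂ (in-window (lastEdge-∈ n))

lemma9 : (k t : ℕ) → (e r : Fin t → ℕ) →
    1 ≤ k → (∀ i → 1 ≤ e i) → (∀ i → r i ≤ k) →
    (R : ℕ) → IsOrderedRamseyNumber k t (λ i → NestedMatching k (r i) (e i)) R →
    k * (1 + sumFin t (λ i → e i ∸ 1)) ≤ R
lemma9 (suc k′) t e r (s≤s z≤n) _ r≤k R (R-arrows , _) with suc k′ * (1 + sumFin t (λ i → e i ∸ 1)) ≤? R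
... | yes bound = bound
... | no ¬bound = ⊥-elim (Nested.no-copy-in-window k′ (r j) (r≤k j) (e j ∸ 1) t R colouring j
                             (offset P W (λ _ → 0) j) (λ S S∈ → colouring-fits S S∈) copy)
  where
  k : ℕ
  k = suc k′
  P W : Fin t → ℕ
  P i = k ∸ r i
  W i = k * (e i ∸ 1)
  -- R < k (1 + Σ (e_i − 1)) = k + Σ W: the windows have room for all gaps.
  room : suc R ≤ sumFin t W + k
  room = subst (suc R ≤_) (begin
    k * (1 + sumFin t (λ i → e i ∸ 1))       ≡⟨ *-distribˡ-+ k 1 _ ⟩
    k * 1 + k * sumFin t (λ i → e i ∸ 1)     ≡⟨ cong₂ _+_ (*-identityʳ k) (*-sumFin k t (λ i → e i ∸ 1)) ⟩
    k + sumFin t W                           ≡⟨ +-comm k (sumFin t W) ⟩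
    sumFin t W + k                           ∎) (≰⇒> ¬bound)
    where open ≡-Reasoning
  open WindowColouring k t R P W (λ i → m∸n≤m k (r i)) room
  j : Fin t
  j = proj₁ (R-arrows colouring)
  copy : ContainedInColour k t R (NestedMatching k (r j) (e j)) colouring j
  copy = proj₂ (R-arrows colouring)
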